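{- Let $A$ be a ring and $\mathbf{x}=(x_0,x_1,x_2,\dots)\in W(A)$. If $x_0$ is not a zero divisor in $A$, then the map $W(A)\to W(A)$, $\mathbf{a}\mapsto T_{\mathbf{a}}\mathbf{x}$, is injective. If $x_0$ is invertible, this map is bijective.
   Context: $W(A)$ is the ring of ($p$-typical) Witt vectors over $A$, $V$ the Verschiebung, $[x]=(x,0,0,\dots)$ the Teichmüller representative. For $\mathbf{a}=(a_0,a_1,\dots)\in W(A)$, $T_{\mathbf{a}}\mathbf{x}=\sum_{k\ge0}V^k([a_k]\mathbf{x})$. -}

module Defs where

-- p-typical Witt vectors W(A) over a commutative ring A, for a fixed prime p.
-- The ring operations of W(A) are defined, as usual, through the universal
-- Witt addition / multiplication polynomials S_n, P_n ∈ ℤ[X_0..X_n,Y_0..Y_n],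
-- characterised by  w_n(S) = w_n(X) + w_n(Y),  w_n(P) = w_n(X) · w_n(Y),
-- where w_n(X) = Σ_{i≤n} p^i X_i^{p^(n-i)} is the n-th ghost polynomial.
-- They are computed by the standard recursion
--   S_n = ( w_n-target − Σ_{i<n} p^i S_i^{p^(n-i)} ) / p^n ,
-- with explicit multivariate integer polynomials; the division by p^n is
-- exact (the classical integrality theorem), so coefficientwise integer
-- division gives exactly the Witt polynomials.

open import Level using (Level)
open import Data.Nat as ℕ using (ℕ; zero; suc; _∸_; _<ᵇ_; _≡ᵇ_)
open import Data.Integer as ℤ using (ℤ; +_; -[1+_])
open import Data.Product using (_×_; _,_; ∃)
open import Data.List as List using (List; []; _∷_; _++_; foldr; map; concatMap; zip; downFrom; upTo)
open import Data.Vec as Vec using (Vec; []; _∷_; zipWith; replicate; tabulate)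
open import Data.Vec.Properties using (≡-dec)
open import Data.Fin using (Fin; toℕ) renaming (zero to fzero; suc to fsuc)
open import Data.Bool using (if_then_else_)
open import Relation.Nullary using (yes; no)
open import Algebra.Bundles using (CommutativeRing)
open import Function using (_∘_)

Mono : ℕ → Set
Mono m = Vec ℕ m

Poly : ℕ → Set
Poly m = List (ℤ × Mono m)

module _ {m : ℕ} where

  insertT : ℤ × Mono m → Poly m → Poly m
  insertT t [] = t ∷ []
  insertT (c , e) ((d , f) ∷ ps) with ≡-dec ℕ._≟_ e f
  ... | yes _ = (c ℤ.+ d , f) ∷ ps
  ... | no  _ = (d , f) ∷ insertT (c , e) ps

  normP : Poly m → Poly m
  normP = foldr insertT []

  zeroP : Poly m
  zeroP = []

  constP : ℤ → Poly m
  constP c = (c , replicate m 0) ∷ []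

  varP : ℕ → Poly m
  varP i = (+ 1 , tabulate (λ j → if toℕ j ≡ᵇ i then 1 else 0)) ∷ []

  addP : Poly m → Poly m → Poly m
  addP P Q = normP (P ++ Q)

  negP : Poly m → Poly m
  negP = map (λ { (c , e) → (ℤ.- c , e) })

  subP : Poly m → Poly m → Poly m
  subP P Q = addP P (negP Q)

  scaleP : ℤ → Poly m → Poly m
  scaleP c = map (λ { (d , e) → (c ℤ.* d , e) })

  mulP : Poly m → Poly m → Poly m
  mulP P Q = normP (concatMap (λ { (c , e) → map (λ { (d , f) → (c ℤ.* d , zipWith ℕ._+_ e f) }) Q }) P)

  powP : Poly m → ℕ → Poly m
  powP P zero    = constP (+ 1)
  powP P (suc k) = mulP P (powP P k)

  sumP : List (Poly m) → Poly m
  sumP = foldr addP zeroP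

  divP : ℕ → Poly m → Poly m
  divP zero    P = P
  divP (suc d) P = map (λ { (c , e) → (c ℤ./ℕ suc d , e) }) (normP P)

-- Witt-type recursion: given target ghost polynomials g_0, g_1, …,
-- produce the polynomials Φ_0, Φ_1, … with
--   Σ_{i≤n} p^i Φ_i^{p^(n-i)} = g_n .

module WittRec (p : ℕ) {m : ℕ} (g : ℕ → Poly m) where

  -- comps n = [Φ_n, Φ_{n-1}, …, Φ_0]
  comps : ℕ → List (Poly m)
  comps zero    = g 0 ∷ []
  comps (suc n) =
    divP (p ℕ.^ suc n)
         (subP (g (suc n))
               (sumP (map (λ { (i , Φi) → scaleP (+ (p ℕ.^ i)) (powP Φi (p ℕ.^ (suc n ∸ i))) })
                          (zip (downFrom (suc n)) prev))))
    ∷ prev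
    where prev = comps n

  headP : List (Poly m) → Poly m
  headP []      = zeroP
  headP (P ∷ _) = P

  Φ : ℕ → Poly m
  Φ n = headP (comps n)

module Witt {c ℓ : Level} (p : ℕ) (R : CommutativeRing c ℓ) where

  open CommutativeRing R

  W : Set c
  W = ℕ → Carrier

  _≈W_ : W → W → Set ℓ
  x ≈W y = ∀ n → x n ≈ y n

  natC : ℕ → Carrier
  natC zero    = 0#
  natC (suc n) = 1# + natC n

  intC : ℤ → Carrier
  intC (+ n)    = natC n
  intC -[1+ n ] = - natC (suc n)

  powC : Carrier → ℕ → Carrier
  powC a zero    = 1#
  powC a (suc k) = a * powC a k

  monoEval : ∀ {m} → Mono m → (Fin m → Carrier) → Carrier
  monoEval []      ρ = 1#
  monoEval (k ∷ e) ρ = powC (ρ fzero) k * monoEval e (ρ ∘ fsuc)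

  evalP : ∀ {m} → Poly m → (Fin m → Carrier) → Carrier
  evalP P ρ = foldr (λ { (c , e) acc → intC c * monoEval e ρ + acc }) 0# P

  -- Variables for the n-th component: X_0..X_n are indices 0..n,
  -- Y_0..Y_n are indices n+1..2n+1.
  NV : ℕ → ℕ
  NV n = suc n ℕ.+ suc n

  X : (n i : ℕ) → Poly (NV n)
  X n i = varP i

  Y : (n i : ℕ) → Poly (NV n)
  Y n i = varP (suc n ℕ.+ i)

  ghost : (n : ℕ) → (ℕ → Poly (NV n)) → ℕ → Poly (NV n)
  ghost n Z k = sumP (map (λ i → scaleP (+ (p ℕ.^ i)) (powP (Z i) (p ℕ.^ (k ∸ i)))) (upTo (suc k)))

  Sadd : (n : ℕ) → Poly (NV n)
  Sadd n = WittRec.Φ p (λ k → addP (ghost n (X n) k) (ghost n (Y n) k)) n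

  Pmul : (n : ℕ) → Poly (NV n)
  Pmul n = WittRec.Φ p (λ k → mulP (ghost n (X n) k) (ghost n (Y n) k)) n

  assign : (n : ℕ) → W → W → Fin (NV n) → Carrier
  assign n x y j = if toℕ j <ᵇ suc n then x (toℕ j) else y (toℕ j ∸ suc n)

  _⊕_ : W → W → W
  (x ⊕ y) n = evalP (Sadd n) (assign n x y)

  _⊗_ : W → W → W
  (x ⊗ y) n = evalP (Pmul n) (assign n x y)

  zeroW : W
  zeroW _ = 0#

  teich : Carrier → W
  teich a zero    = a
  teich a (suc _) = 0#

  Ver : W → W
  Ver x zero    = 0#
  Ver x (suc n) = x n

  Ver^ : ℕ → W → W
  Ver^ zero    x = x
  Ver^ (suc k) x = Ver (Ver^ k x)

  -- T_a x = Σ_{k≥0} V^k([a_k] x).  The term V^k(…) has vanishing components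
  -- in degrees < k, and the n-th component of a Witt sum only depends on
  -- components 0..n, so the n-th component of the (V-adically convergent)
  -- infinite sum equals that of the partial sum over k = 0..n.
  T : W → W → W
  T a x n = foldr _⊕_ zeroW (map (λ k → Ver^ k (teich (a k) ⊗ x)) (upTo (suc n))) n

  NonZeroDivisor : Carrier → Set (c Level.⊔ ℓ)
  NonZeroDivisor u = ∀ y → u * y ≈ 0# → y ≈ 0#

  Invertible : Carrier → Set (c Level.⊔ ℓ)
  Invertible u = ∃ λ v → u * v ≈ 1#

{-# OPTIONS --safe #-}
-- Write T_a x = Σ_k V^k([a_k] x).  The k-th summand vanishes below degree k and equals a_k x_0
-- in degree k, and the n-th Witt addition polynomial is X_n + Y_n plus a polynomial in the
-- lower variables X_0 … X_{n-1}, Y_0 … Y_{n-1}.  Hence if a and b agree below n, the n-th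
-- components of T_a x and T_b x differ exactly by (a_n - b_n) x_0.  Injectivity follows by
-- induction on n when x_0 is not a zero divisor; when x_0 has an inverse v, T_a x = y is solved
-- recursively by a_n = v (y_n - (T_a′ x)_n), where a′ is a with its components from n on set to 0.
module Submission where

open import Defs
open import Level using (Level)
open import Data.Nat using (ℕ; NonZero)
open import Data.Nat.Primality using (Prime; prime⇒nonZero)
open import Data.Product using (_×_; _,_)
open import Algebra.Bundles using (CommutativeRing)
open import Function.Definitions using (Injective; Bijective)

module Polynomials where

  open import Data.Nat as ℕ using (zero; suc; _<_; _≡ᵇ_)
  open import Data.Nat.DivMod using (n/n≡1)
  open import Data.Integer as ℤ using (ℤ; +_)
  import Data.Integer.Properties as ℤP
  open import Data.Product using (proj₂)
  open import Data.List using ([]; _∷_; _++_; map; applyUpTo)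
  open import Data.List.Relation.Unary.All using (All; []; _∷_)
  open import Data.Vec using (Vec; []; _∷_; tabulate; zipWith; replicate)
  open import Data.Vec.Properties using (≡-dec)
  open import Data.Fin using (Fin; toℕ; fromℕ<) renaming (zero to fzero; suc to fsuc)
  open import Data.Fin.Properties using (toℕ-fromℕ<)
  open import Data.Bool using (Bool; true; false; if_then_else_)
  open import Data.Empty using (⊥-elim)
  open import Function using (_∘_)
  open import Relation.Binary.PropositionalEquality
  open import Relation.Nullary using (yes; no)

  exponent : ∀ {m} → Vec ℕ m → ℕ → ℕ
  exponent []      k       = 0
  exponent (a ∷ e) zero    = a
  exponent (a ∷ e) (suc k) = exponent e k

  exponent-zipWith-+ : ∀ {m} (e f : Vec ℕ m) k → exponent (zipWith ℕ._+_ e f) k ≡ exponent e k ℕ.+ exponent f k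
  exponent-zipWith-+ []      []      k       = refl
  exponent-zipWith-+ (a ∷ e) (b ∷ f) zero    = refl
  exponent-zipWith-+ (a ∷ e) (b ∷ f) (suc k) = exponent-zipWith-+ e f k

  exponent-replicate-0 : ∀ m k → exponent (replicate m 0) k ≡ 0
  exponent-replicate-0 zero    k       = refl
  exponent-replicate-0 (suc m) zero    = refl
  exponent-replicate-0 (suc m) (suc k) = exponent-replicate-0 m k

  exponent-tabulate : ∀ {m} (f : Fin m → ℕ) j → exponent (tabulate f) (toℕ j) ≡ f j
  exponent-tabulate f fzero    = refl
  exponent-tabulate f (fsuc j) = exponent-tabulate (f ∘ fsuc) j

  exponent-tabulate-0 : ∀ {m} (f : Fin m → ℕ) k → (∀ j → toℕ j ≡ k → f j ≡ 0) → exponent (tabulate f) k ≡ 0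
  exponent-tabulate-0 {zero}  f k       f≡0 = refl
  exponent-tabulate-0 {suc m} f zero    f≡0 = f≡0 fzero refl
  exponent-tabulate-0 {suc m} f (suc k) f≡0 = exponent-tabulate-0 (f ∘ fsuc) k (λ j eq → f≡0 (fsuc j) (cong suc eq))

  ≢⇒≡ᵇ-false : ∀ m n → m ≢ n → (m ≡ᵇ n) ≡ false
  ≢⇒≡ᵇ-false zero    zero    m≢n = ⊥-elim (m≢n refl)
  ≢⇒≡ᵇ-false zero    (suc n) m≢n = refl
  ≢⇒≡ᵇ-false (suc m) zero    m≢n = refl
  ≢⇒≡ᵇ-false (suc m) (suc n) m≢n = ≢⇒≡ᵇ-false m n (m≢n ∘ cong suc)

  ≡ᵇ-refl : ∀ n → (n ≡ᵇ n) ≡ true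
  ≡ᵇ-refl zero    = refl
  ≡ᵇ-refl (suc n) = ≡ᵇ-refl n

  unitMono : (m k : ℕ) → Mono m
  unitMono m k = tabulate (λ j → if toℕ j ≡ᵇ k then 1 else 0)

  exponent-unitMono-other : ∀ m {k l} → k ≢ l → exponent (unitMono m k) l ≡ 0
  exponent-unitMono-other m {k} k≢l =
    exponent-tabulate-0 {m} _ _ λ { j refl → cong (if_then 1 else 0) (≢⇒≡ᵇ-false (toℕ j) k (k≢l ∘ sym)) }

  exponent-unitMono-self : ∀ {m k} → k < m → exponent (unitMono m k) k ≡ 1
  exponent-unitMono-self {m} k<m = subst (λ k → exponent (unitMono m k) k ≡ 1) (toℕ-fromℕ< k<m) (exponent-at-self (fromℕ< k<m))
    where
    exponent-at-self : (j : Fin m) → exponent (unitMono m (toℕ j)) (toℕ j) ≡ 1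
    exponent-at-self j = trans (exponent-tabulate _ j) (cong (if_then 1 else 0) (≡ᵇ-refl (toℕ j)))

  restrict : ∀ {m} → (Mono m → Bool) → Poly m → Poly m
  restrict b []      = []
  restrict b (t ∷ P) = if b (proj₂ t) then t ∷ restrict b P else restrict b P

  module _ {m : ℕ} where

    insertT-same : ∀ c d (e : Mono m) P → insertT (c , e) ((d , e) ∷ P) ≡ (c ℤ.+ d , e) ∷ P
    insertT-same c d e P with ≡-dec ℕ._≟_ e e
    ... | yes _  = refl
    ... | no e≢e = ⊥-elim (e≢e refl)

    insertT-other : ∀ c d (e f : Mono m) P → e ≢ f → insertT (c , e) ((d , f) ∷ P) ≡ (d , f) ∷ insertT (c , e) P
    insertT-other c d e f P e≢f with ≡-dec ℕ._≟_ e f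
    ... | yes e≡f = ⊥-elim (e≢f e≡f)
    ... | no _    = refl

    normP-pair : ∀ c d (e f : Mono m) → e ≢ f → normP ((c , e) ∷ (d , f) ∷ []) ≡ (d , f) ∷ (c , e) ∷ []
    normP-pair c d e f = insertT-other c d e f []

    restrict-++ : ∀ (b : Mono m → Bool) P Q → restrict b (P ++ Q) ≡ restrict b P ++ restrict b Q
    restrict-++ b []      Q = refl
    restrict-++ b (t ∷ P) Q with b (proj₂ t)
    ... | true  = cong (t ∷_) (restrict-++ b P Q)
    ... | false = restrict-++ b P Q

    restrict-insertT-kept : ∀ (b : Mono m → Bool) c e P → b e ≡ true →
                            restrict b (insertT (c , e) P) ≡ insertT (c , e) (restrict b P)
    restrict-insertT-kept b c e []            be rewrite be = refl
    restrict-insertT-kept b c e ((d , f) ∷ P) be with ≡-dec ℕ._≟_ e f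
    ... | yes refl rewrite be | insertT-same c d e (restrict b P) = refl
    ... | no e≢f with b f
    ...   | true  rewrite insertT-other c d e f (restrict b P) e≢f = cong ((d , f) ∷_) (restrict-insertT-kept b c e P be)
    ...   | false = restrict-insertT-kept b c e P be

    restrict-insertT-dropped : ∀ (b : Mono m → Bool) c e P → b e ≡ false →
                               restrict b (insertT (c , e) P) ≡ restrict b P
    restrict-insertT-dropped b c e []            be rewrite be = refl
    restrict-insertT-dropped b c e ((d , f) ∷ P) be with ≡-dec ℕ._≟_ e f
    ... | yes refl rewrite be = refl
    ... | no _ with b f
    ...   | true  = cong ((d , f) ∷_) (restrict-insertT-dropped b c e P be)
    ...   | false = restrict-insertT-dropped b c e P be

    restrict-normP : ∀ (b : Mono m → Bool) P → restrict b (normP P) ≡ normP (restrict b P)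
    restrict-normP b []            = refl
    restrict-normP b ((c , e) ∷ P) with b e in be
    ... | true  rewrite restrict-insertT-kept b c e (normP P) be | restrict-normP b P = refl
    ... | false rewrite restrict-insertT-dropped b c e (normP P) be = restrict-normP b P

    restrict-addP : ∀ (b : Mono m → Bool) P Q → restrict b (addP P Q) ≡ addP (restrict b P) (restrict b Q)
    restrict-addP b P Q rewrite restrict-normP b (P ++ Q) | restrict-++ b P Q = refl

    restrict-sumP : ∀ (b : Mono m → Bool) Ps → restrict b (sumP Ps) ≡ sumP (map (restrict b) Ps)
    restrict-sumP b []       = refl
    restrict-sumP b (P ∷ Ps) rewrite restrict-addP b P (sumP Ps) | restrict-sumP b Ps = refl

    restrict-map : ∀ (b : Mono m → Bool) (h : ℤ × Mono m → ℤ × Mono m) → (∀ t → proj₂ (h t) ≡ proj₂ t) →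
                   ∀ P → restrict b (map h P) ≡ map h (restrict b P)
    restrict-map b h h-mono []      = refl
    restrict-map b h h-mono (t ∷ P) rewrite h-mono t with b (proj₂ t)
    ... | true  = cong (h t ∷_) (restrict-map b h h-mono P)
    ... | false = restrict-map b h h-mono P

    restrict-divP : ∀ b d (P : Poly m) → restrict b (divP d P) ≡ divP d (restrict b P)
    restrict-divP b zero    P = refl
    restrict-divP b (suc d) P = trans (restrict-map b _ (λ _ → refl) (normP P)) (cong (map _) (restrict-normP b P))

    restrict-kept : ∀ (b : Mono m → Bool) P → All (λ t → b (proj₂ t) ≡ true) P → restrict b P ≡ P
    restrict-kept b []      []         = refl
    restrict-kept b (t ∷ P) (bt ∷ bP) rewrite bt = cong (t ∷_) (restrict-kept b P bP)

    restrict-dropped : ∀ (b : Mono m → Bool) P → All (λ t → b (proj₂ t) ≡ false) P → restrict b P ≡ []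
    restrict-dropped b []      []         = refl
    restrict-dropped b (t ∷ P) (bt ∷ bP) rewrite bt = restrict-dropped b P bP

    restrict-satisfies : ∀ (b : Mono m → Bool) P → All (λ t → b (proj₂ t) ≡ true) (restrict b P)
    restrict-satisfies b []      = []
    restrict-satisfies b (t ∷ P) with b (proj₂ t) in bt
    ... | true  = bt ∷ restrict-satisfies b P
    ... | false = restrict-satisfies b P

  sumP-applyUpTo-last : ∀ {m} k (F : ℕ → Poly m) t → (∀ i → i < k → F i ≡ []) → F k ≡ t ∷ [] →
                        sumP (applyUpTo F (suc k)) ≡ t ∷ []
  sumP-applyUpTo-last zero    F t F≡[] Fk≡t rewrite Fk≡t = refl
  sumP-applyUpTo-last (suc k) F t F≡[] Fk≡t
    rewrite F≡[] 0 ℕ.z<s | sumP-applyUpTo-last k (F ∘ suc) t (λ i i<k → F≡[] (suc i) (ℕ.s<s i<k)) Fk≡t = refl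

  divP-pair : ∀ {m} d .{{_ : ℕ.NonZero d}} (e f : Mono m) → e ≢ f →
              divP d (addP ((+ d ℤ.* + 1 , e) ∷ (+ d ℤ.* + 1 , f) ∷ []) []) ≡ (+ 1 , e) ∷ (+ 1 , f) ∷ []
  divP-pair (suc d) e f e≢f =
    trans (cong (map _) (trans (cong normP (normP-pair c c e f e≢f)) (normP-pair c c f e (e≢f ∘ sym))))
          (cong (λ c′ → (c′ , e) ∷ (c′ , f) ∷ []) d/d≡1)
    where
    c : ℤ
    c = + suc d ℤ.* + 1
    d/d≡1 : c ℤ./ℕ suc d ≡ + 1
    d/d≡1 = trans (cong (ℤ._/ℕ suc d) (ℤP.*-identityʳ (+ suc d))) (cong +_ (n/n≡1 (suc d)))

module Avoiding (i j : ℕ) where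

  open Polynomials
  open import Data.Nat as ℕ using (zero; suc; _≤_; _∸_; _^_; _≡ᵇ_)
  open import Data.Nat.Properties using (≤-refl; m≤n⇒m≤1+n)
  open import Data.Integer using (ℤ; +_)
  open import Data.Product using (Σ; proj₂)
  open import Data.List using ([]; _∷_; _++_; map; zip; downFrom; concatMap)
  open import Data.List.Relation.Unary.All as All using (All; []; _∷_)
  open import Data.List.Relation.Unary.All.Properties using (++⁺; map⁺)
  open import Data.Vec using (zipWith; replicate)
  open import Data.Vec.Properties using (≡-dec)
  open import Data.Bool using (Bool; true; not; _∧_)
  open import Function using (_∘_)
  open import Relation.Binary.PropositionalEquality
  open import Relation.Nullary using (yes; no)

  avoids : ∀ {m} → Mono m → Bool
  avoids e = (exponent e i ≡ᵇ 0) ∧ (exponent e j ≡ᵇ 0)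

  mentions : ∀ {m} → Mono m → Bool
  mentions e = not (avoids e)

  Avoids : ∀ {m} → Poly m → Set
  Avoids = All (λ t → avoids (proj₂ t) ≡ true)

  avoids-intro : ∀ {m} (e : Mono m) → exponent e i ≡ 0 → exponent e j ≡ 0 → avoids e ≡ true
  avoids-intro e ei≡0 ej≡0 rewrite ei≡0 | ej≡0 = refl

  avoids-elim : ∀ {m} (e : Mono m) → avoids e ≡ true → exponent e i ≡ 0 × exponent e j ≡ 0
  avoids-elim e = both-zero (exponent e i) (exponent e j)
    where
    both-zero : ∀ a b → (a ≡ᵇ 0) ∧ (b ≡ᵇ 0) ≡ true → a ≡ 0 × b ≡ 0
    both-zero zero    zero    _  = refl , refl
    both-zero zero    (suc b) ()
    both-zero (suc a) b       ()

  avoids-zipWith-+ : ∀ {m} (e f : Mono m) → avoids e ≡ true → avoids f ≡ true → avoids (zipWith ℕ._+_ e f) ≡ true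
  avoids-zipWith-+ e f ae af with avoids-elim e ae | avoids-elim f af
  ... | ei , ej | fi , fj = avoids-intro (zipWith ℕ._+_ e f)
                              (trans (exponent-zipWith-+ e f i) (cong₂ ℕ._+_ ei fi))
                              (trans (exponent-zipWith-+ e f j) (cong₂ ℕ._+_ ej fj))

  module _ {m : ℕ} where

    Avoids-map : ∀ (h : ℤ × Mono m → ℤ × Mono m) → (∀ t → avoids (proj₂ t) ≡ true → avoids (proj₂ (h t)) ≡ true) →
                 ∀ {P} → Avoids P → Avoids (map h P)
    Avoids-map h h-avoids aP = map⁺ (All.map (h-avoids _) aP)

    Avoids-insertT : ∀ c (e : Mono m) P → avoids e ≡ true → Avoids P → Avoids (insertT (c , e) P)
    Avoids-insertT c e []            ae []         = ae ∷ []
    Avoids-insertT c e ((d , f) ∷ P) ae (af ∷ aP) with ≡-dec ℕ._≟_ e f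
    ... | yes refl = af ∷ aP
    ... | no _     = af ∷ Avoids-insertT c e P ae aP

    Avoids-normP : ∀ P → Avoids P → Avoids (normP {m} P)
    Avoids-normP []            []        = []
    Avoids-normP ((c , e) ∷ P) (ae ∷ aP) = Avoids-insertT c e (normP P) ae (Avoids-normP P aP)

    Avoids-addP : ∀ P Q → Avoids P → Avoids Q → Avoids (addP {m} P Q)
    Avoids-addP P Q aP aQ = Avoids-normP (P ++ Q) (++⁺ aP aQ)

    Avoids-negP : ∀ {P} → Avoids P → Avoids (negP {m} P)
    Avoids-negP = Avoids-map _ (λ _ ae → ae)

    Avoids-subP : ∀ P Q → Avoids P → Avoids Q → Avoids (subP {m} P Q)
    Avoids-subP P Q aP aQ = Avoids-addP P (negP Q) aP (Avoids-negP aQ)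

    Avoids-scaleP : ∀ c {P} → Avoids P → Avoids (scaleP {m} c P)
    Avoids-scaleP c = Avoids-map _ (λ _ ae → ae)

    Avoids-divP : ∀ d P → Avoids P → Avoids (divP {m} d P)
    Avoids-divP zero    P aP = aP
    Avoids-divP (suc d) P aP = Avoids-map _ (λ _ ae → ae) (Avoids-normP P aP)

    Avoids-concatMap : ∀ (F : ℤ × Mono m → Poly m) → (∀ c e → avoids e ≡ true → Avoids (F (c , e))) →
                       ∀ P → Avoids P → Avoids (concatMap F P)
    Avoids-concatMap F F-avoids []            []        = []
    Avoids-concatMap F F-avoids ((c , e) ∷ P) (ae ∷ aP) = ++⁺ (F-avoids c e ae) (Avoids-concatMap F F-avoids P aP)

    Avoids-mulP : ∀ P Q → Avoids P → Avoids Q → Avoids (mulP {m} P Q)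
    Avoids-mulP P Q aP aQ =
      Avoids-normP _ (Avoids-concatMap _ (λ c e ae → Avoids-map _ (λ { (d , f) af → avoids-zipWith-+ e f ae af }) aQ) P aP)

    Avoids-constP : ∀ c → Avoids (constP {m} c)
    Avoids-constP c = avoids-intro (replicate m 0) (exponent-replicate-0 m i) (exponent-replicate-0 m j) ∷ []

    Avoids-powP : ∀ P k → Avoids P → Avoids (powP {m} P k)
    Avoids-powP P zero    aP = Avoids-constP _
    Avoids-powP P (suc k) aP = Avoids-mulP P (powP P k) aP (Avoids-powP P k aP)

    Avoids-sumP : ∀ Ps → All Avoids Ps → Avoids (sumP {m} Ps)
    Avoids-sumP []       []         = []
    Avoids-sumP (P ∷ Ps) (aP ∷ aPs) = Avoids-addP P (sumP Ps) aP (Avoids-sumP Ps aPs)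

    Avoids-varP : ∀ k → k ≢ i → k ≢ j → Avoids (varP {m} k)
    Avoids-varP k k≢i k≢j = avoids-intro (unitMono m k) (exponent-unitMono-other m k≢i) (exponent-unitMono-other m k≢j) ∷ []

    restrict-mentions : ∀ (P : Poly m) → Avoids P → restrict mentions P ≡ []
    restrict-mentions P aP = restrict-dropped mentions P (All.map (cong not) aP)

  restrict-mentions-subP : ∀ {m} (P Q : Poly m) → Avoids Q →
                             restrict mentions (subP P Q) ≡ addP (restrict mentions P) []
  restrict-mentions-subP P Q aQ =
    trans (restrict-addP _ P (negP Q)) (cong (addP (restrict mentions P)) (restrict-mentions (negP Q) (Avoids-negP aQ)))

  module _ (p : ℕ) {m : ℕ} (g : ℕ → Poly m) where
    open WittRec p g

    private
      Avoids-sum-zip : ∀ (h : ℕ × Poly m → Poly m) → (∀ k Φ → Avoids Φ → Avoids (h (k , Φ))) →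
                       ∀ ks Φs → All Avoids Φs → Avoids (sumP (map h (zip ks Φs)))
      Avoids-sum-zip h h-avoids ks Φs aΦs = Avoids-sumP _ (go ks Φs aΦs)
        where
        go : ∀ ks Φs → All Avoids Φs → All Avoids (map h (zip ks Φs))
        go []       Φs        aΦs         = []
        go (k ∷ ks) []        []          = []
        go (k ∷ ks) (Φ ∷ Φs) (aΦ ∷ aΦs) = h-avoids k Φ aΦ ∷ go ks Φs aΦs

      comps-suc-correction : ∀ n → All Avoids (comps n) →
                             Σ (Poly m) λ C → Avoids C × comps (suc n) ≡ divP (p ^ suc n) (subP (g (suc n)) C) ∷ comps n
      comps-suc-correction n aΦs =
        _ , Avoids-sum-zip _ (λ k Φ aΦ → Avoids-scaleP (+ (p ^ k)) (Avoids-powP Φ (p ^ (suc n ∸ k)) aΦ))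
                             (downFrom (suc n)) (comps n) aΦs , refl

    All-Avoids-comps-suc : ∀ n → All Avoids (comps n) → Avoids (g (suc n)) → All Avoids (comps (suc n))
    All-Avoids-comps-suc n aΦs ag with comps-suc-correction n aΦs
    ... | C , aC , eq = subst (All Avoids) (sym eq) (Avoids-divP (p ^ suc n) _ (Avoids-subP (g (suc n)) C ag aC) ∷ aΦs)

    All-Avoids-comps : ∀ n → (∀ k → k ≤ n → Avoids (g k)) → All Avoids (comps n)
    All-Avoids-comps zero    ag = ag 0 ℕ.z≤n ∷ []
    All-Avoids-comps (suc n) ag =
      All-Avoids-comps-suc n (All-Avoids-comps n (λ k k≤n → ag k (m≤n⇒m≤1+n k≤n))) (ag (suc n) ≤-refl)

    restrict-mentions-Φ-suc : ∀ n → (∀ k → k ≤ n → Avoids (g k)) →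
                                restrict mentions (Φ (suc n)) ≡ divP (p ^ suc n) (addP (restrict mentions (g (suc n))) [])
    restrict-mentions-Φ-suc n ag with comps-suc-correction n (All-Avoids-comps n ag)
    ... | C , aC , eq = begin
      restrict mentions (Φ (suc n))                              ≡⟨ cong (restrict mentions ∘ headP) eq ⟩
      restrict mentions (divP (p ^ suc n) (subP (g (suc n)) C))  ≡⟨ restrict-divP _ (p ^ suc n) (subP (g (suc n)) C) ⟩
      divP (p ^ suc n) (restrict mentions (subP (g (suc n)) C))  ≡⟨ cong (divP (p ^ suc n)) (restrict-mentions-subP (g (suc n)) C aC) ⟩
      divP (p ^ suc n) (addP (restrict mentions (g (suc n))) []) ∎
      where open ≡-Reasoning

module AdditionPolynomial {c ℓ : Level} (p : ℕ) (R : CommutativeRing c ℓ) where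

  open Polynomials
  open Witt p R
  open import Data.Nat as ℕ using (zero; suc; _<_; _≤_; _∸_; _^_; NonZero)
  open import Data.Nat.Properties
    using (m^n≢0; <⇒≢; m≤m+n; m≤n+m; +-monoʳ-<; n<1+n; +-cancelˡ-≡; <-≤-trans; n∸n≡0; +-identityʳ)
  open import Data.Integer as ℤ using (ℤ; +_)
  open import Data.List using ([]; _∷_; map; upTo; applyUpTo)
  open import Data.List.Properties using (map-∘; map-upTo)
  open import Data.List.Relation.Unary.All using ([]; _∷_)
  open import Data.List.Relation.Unary.All.Properties using (map⁺; applyUpTo⁺₁)
  open import Data.Vec.Properties using (zipWith-identityʳ)
  open import Data.Bool using (true)
  open import Function using (_∘_)
  open import Relation.Binary.PropositionalEquality

  yIndex : ℕ → ℕ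
  yIndex N = suc N ℕ.+ N

  N<NV : ∀ N → N < NV N
  N<NV N = m≤m+n (suc N) (suc N)

  yIndex<NV : ∀ N → yIndex N < NV N
  yIndex<NV N = +-monoʳ-< (suc N) (n<1+n N)

  N≢yIndex : ∀ N → N ≢ yIndex N
  N≢yIndex N = <⇒≢ (m≤m+n (suc N) N)

  ghostSum : (N : ℕ) → ℕ → Poly (NV N)
  ghostSum N k = addP (ghost N (X N) k) (ghost N (Y N) k)

  module _ (N : ℕ) where
    open Avoiding N (yIndex N)

    Avoids-ghost : ∀ Z k → (∀ i → i ≤ k → Avoids (Z i)) → Avoids (ghost N Z k)
    Avoids-ghost Z k aZ = Avoids-sumP _ (map⁺ {f = summand} (applyUpTo⁺₁ (λ i → i) (suc k) λ {i} i≤k →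
      Avoids-scaleP (+ (p ^ i)) (Avoids-powP (Z i) (p ^ (k ∸ i)) (aZ i (ℕ.≤-pred i≤k)))))
      where
      summand : ℕ → Poly (NV N)
      summand i = scaleP (+ (p ^ i)) (powP (Z i) (p ^ (k ∸ i)))

    Avoids-X : ∀ i → i < N → Avoids (X N i)
    Avoids-X i i<N = Avoids-varP i (<⇒≢ i<N) (<⇒≢ (<-≤-trans i<N (m≤n+m N (suc N))))

    Avoids-Y : ∀ i → i < N → Avoids (Y N i)
    Avoids-Y i i<N = Avoids-varP (suc N ℕ.+ i) (λ eq → <⇒≢ (ℕ.s≤s (m≤m+n N i)) (sym eq))
                                               (λ eq → <⇒≢ i<N (+-cancelˡ-≡ (suc N) i N eq))

    Avoids-ghostSum : ∀ k → k < N → Avoids (ghostSum N k)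
    Avoids-ghostSum k k<N =
      Avoids-addP _ _ (Avoids-ghost (X N) k (λ i i≤k → Avoids-X i (<-≤-trans (ℕ.s≤s i≤k) k<N)))
                      (Avoids-ghost (Y N) k (λ i i≤k → Avoids-Y i (<-≤-trans (ℕ.s≤s i≤k) k<N)))

    scaleP-powP-varP-1 : ∀ c t → scaleP c (powP (varP {NV N} t) 1) ≡ (c ℤ.* + 1 , unitMono (NV N) t) ∷ []
    scaleP-powP-varP-1 c t = cong (λ e → (c ℤ.* + 1 , e) ∷ []) (zipWith-identityʳ +-identityʳ (unitMono (NV N) t))

    restrict-ghost-top : ∀ Z t → (∀ i → i < N → Avoids (Z i)) → Z N ≡ varP t → mentions (unitMono (NV N) t) ≡ true →
                         restrict mentions (ghost N Z N) ≡ (+ (p ^ N) ℤ.* + 1 , unitMono (NV N) t) ∷ []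
    restrict-ghost-top Z t aZ ZN≡t t-occurs = begin
      restrict mentions (sumP (map f (upTo (suc N))))        ≡⟨ restrict-sumP mentions (map f (upTo (suc N))) ⟩
      sumP (map (restrict mentions) (map f (upTo (suc N))))  ≡⟨ cong sumP (sym (map-∘ {g = restrict mentions} {f = f} (upTo (suc N)))) ⟩
      sumP (map (restrict mentions ∘ f) (upTo (suc N)))      ≡⟨ cong sumP (map-upTo (restrict mentions ∘ f) (suc N)) ⟩
      sumP (applyUpTo (restrict mentions ∘ f) (suc N))       ≡⟨ sumP-applyUpTo-last N _ _ below top ⟩
      (+ (p ^ N) ℤ.* + 1 , unitMono (NV N) t) ∷ []           ∎
      where
      open ≡-Reasoning
      f : ℕ → Poly (NV N)
      f i = scaleP (+ (p ^ i)) (powP (Z i) (p ^ (N ∸ i)))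
      below : ∀ i → i < N → restrict mentions (f i) ≡ []
      below i i<N = restrict-mentions (f i) (Avoids-scaleP (+ (p ^ i)) (Avoids-powP (Z i) (p ^ (N ∸ i)) (aZ i i<N)))
      top : restrict mentions (f N) ≡ (+ (p ^ N) ℤ.* + 1 , unitMono (NV N) t) ∷ []
      top rewrite n∸n≡0 N | ZN≡t =
        trans (cong (restrict mentions) (scaleP-powP-varP-1 (+ (p ^ N)) t)) (restrict-kept mentions _ (t-occurs ∷ []))

    xMono yMono : Mono (NV N)
    xMono = unitMono (NV N) N
    yMono = unitMono (NV N) (yIndex N)

    mentions-xMono : mentions xMono ≡ true
    mentions-xMono rewrite exponent-unitMono-self (N<NV N) = refl

    mentions-yMono : mentions yMono ≡ true
    mentions-yMono rewrite exponent-unitMono-other (NV N) (N≢yIndex N ∘ sym) | exponent-unitMono-self (yIndex<NV N) = refl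

    xMono≢yMono : xMono ≢ yMono
    xMono≢yMono x≡y = 1≢0 (trans (sym (exponent-unitMono-self (N<NV N)))
                               (trans (cong (λ e → exponent e N) x≡y) (exponent-unitMono-other (NV N) (N≢yIndex N ∘ sym))))
      where
      1≢0 : 1 ≢ 0
      1≢0 ()

    restrict-ghostSum-top :
      restrict mentions (ghostSum N N) ≡ (+ (p ^ N) ℤ.* + 1 , yMono) ∷ (+ (p ^ N) ℤ.* + 1 , xMono) ∷ []
    restrict-ghostSum-top = begin
      restrict mentions (ghostSum N N)
        ≡⟨ restrict-addP mentions (ghost N (X N) N) (ghost N (Y N) N) ⟩
      addP (restrict mentions (ghost N (X N) N)) (restrict mentions (ghost N (Y N) N))
        ≡⟨ cong₂ addP ghostX-top ghostY-top ⟩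
      normP ((pᴺ , xMono) ∷ (pᴺ , yMono) ∷ [])
        ≡⟨ normP-pair pᴺ pᴺ xMono yMono xMono≢yMono ⟩
      (pᴺ , yMono) ∷ (pᴺ , xMono) ∷ []
        ∎
      where
      open ≡-Reasoning
      pᴺ : ℤ
      pᴺ = + (p ^ N) ℤ.* + 1
      ghostX-top : restrict mentions (ghost N (X N) N) ≡ (pᴺ , xMono) ∷ []
      ghostX-top = restrict-ghost-top (X N) N Avoids-X refl mentions-xMono
      ghostY-top : restrict mentions (ghost N (Y N) N) ≡ (pᴺ , yMono) ∷ []
      ghostY-top = restrict-ghost-top (Y N) (yIndex N) Avoids-Y refl mentions-yMono

  -- In the recursion for S_N only the ghost terms p^N X_N + p^N Y_N involve X_N or Y_N, and
  -- the division by p^N acts coefficientwise.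
  restrict-mentions-Sadd : ∀ N .{{_ : NonZero p}} →
                           restrict (Avoiding.mentions N (yIndex N)) (Sadd N) ≡ (+ 1 , yMono N) ∷ (+ 1 , xMono N) ∷ []
  restrict-mentions-Sadd zero    = refl
  restrict-mentions-Sadd (suc n) = begin
    restrict mentions (Sadd (suc n))
      ≡⟨ restrict-mentions-Φ-suc p (ghostSum (suc n)) n (λ k k≤n → Avoids-ghostSum (suc n) k (ℕ.s≤s k≤n)) ⟩
    divP (p ^ suc n) (addP (restrict mentions (ghostSum (suc n) (suc n))) [])
      ≡⟨ cong (λ P → divP (p ^ suc n) (addP P [])) (restrict-ghostSum-top (suc n)) ⟩
    divP (p ^ suc n) (addP ((pᴺ , yMono (suc n)) ∷ (pᴺ , xMono (suc n)) ∷ []) [])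
      ≡⟨ divP-pair (p ^ suc n) {{m^n≢0 p (suc n)}} (yMono (suc n)) (xMono (suc n)) (xMono≢yMono (suc n) ∘ sym) ⟩
    (+ 1 , yMono (suc n)) ∷ (+ 1 , xMono (suc n)) ∷ []
      ∎
    where
    open ≡-Reasoning
    open Avoiding (suc n) (yIndex (suc n))
    pᴺ : ℤ
    pᴺ = + (p ^ suc n) ℤ.* + 1

module Evaluation {c ℓ : Level} (p : ℕ) (R : CommutativeRing c ℓ) where

  open Polynomials
  open AdditionPolynomial p R
  open Witt p R
  open CommutativeRing R
  open import Algebra.Properties.CommutativeSemigroup +-commutativeSemigroup using (x∙yz≈y∙xz)
  open import Data.Nat as ℕ using (zero; suc; _<_; _≤_; _∸_; _<ᵇ_)
  open import Data.Nat.Properties using (<ᵇ⇒<; <⇒<ᵇ; ≮⇒≥; ≤⇒≯; m+n∸m≡n; n<1+n; m≤m+n)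
  open import Data.Integer using (+_)
  open import Data.Product using (proj₂)
  open import Data.Sum using (_⊎_; inj₁; inj₂)
  open import Data.List using ([]; _∷_)
  open import Data.List.Relation.Unary.All using (All; []; _∷_)
  open import Data.Vec using ([]; _∷_; tabulate)
  open import Data.Fin using (Fin; toℕ; fromℕ<) renaming (zero to fzero; suc to fsuc)
  open import Data.Fin.Properties using (toℕ-fromℕ<)
  open import Data.Bool using (Bool; true; false; not) renaming (T to IsTrue)
  open import Data.Unit using (tt)
  open import Data.Empty using (⊥-elim)
  open import Function using (_∘_)
  open import Relation.Binary.PropositionalEquality as ≡ using (_≡_)

  evalP-restrict : ∀ {m} (b : Mono m → Bool) P ρ →
                   evalP P ρ ≈ evalP (restrict (not ∘ b) P) ρ + evalP (restrict b P) ρ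
  evalP-restrict b []            ρ = sym (+-identityʳ 0#)
  evalP-restrict b ((k , e) ∷ P) ρ with b e
  ... | true  = trans (+-congˡ (evalP-restrict b P ρ)) (x∙yz≈y∙xz _ _ _)
  ... | false = trans (+-congˡ (evalP-restrict b P ρ)) (sym (+-assoc _ _ _))

  evalP-monic : ∀ {m} (e : Mono m) P ρ → evalP ((+ 1 , e) ∷ P) ρ ≈ monoEval e ρ + evalP P ρ
  evalP-monic e P ρ = +-congʳ (trans (*-congʳ (+-identityʳ 1#)) (*-identityˡ _))

  powC-cong : ∀ {a b} k → a ≈ b → powC a k ≈ powC b k
  powC-cong zero    a≈b = refl
  powC-cong (suc k) a≈b = *-cong a≈b (powC-cong k a≈b)

  AgreeOnVariablesOf : ∀ {m} → (Fin m → Carrier) → (Fin m → Carrier) → Mono m → Set ℓ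
  AgreeOnVariablesOf ρ σ e = ∀ j → exponent e (toℕ j) ≡ 0 ⊎ ρ j ≈ σ j

  monoEval-cong : ∀ {m} (e : Mono m) ρ σ → AgreeOnVariablesOf ρ σ e → monoEval e ρ ≈ monoEval e σ
  monoEval-cong []      ρ σ ρ≈σ = refl
  monoEval-cong (k ∷ e) ρ σ ρ≈σ with ρ≈σ fzero
  ... | inj₁ ≡.refl = *-congˡ (monoEval-cong e (ρ ∘ fsuc) (σ ∘ fsuc) (ρ≈σ ∘ fsuc))
  ... | inj₂ ρ₀≈σ₀  = *-cong (powC-cong k ρ₀≈σ₀) (monoEval-cong e (ρ ∘ fsuc) (σ ∘ fsuc) (ρ≈σ ∘ fsuc))

  evalP-cong : ∀ {m} (P : Poly m) ρ σ → All (AgreeOnVariablesOf ρ σ ∘ proj₂) P → evalP P ρ ≈ evalP P σ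
  evalP-cong []            ρ σ []          = refl
  evalP-cong ((k , e) ∷ P) ρ σ (ρ≈σ ∷ ρ≈σs) = +-cong (*-congˡ (monoEval-cong e ρ σ ρ≈σ)) (evalP-cong P ρ σ ρ≈σs)

  monoEval-zero : ∀ m (ρ : Fin m → Carrier) → monoEval (tabulate {n = m} (λ _ → 0)) ρ ≈ 1#
  monoEval-zero zero    ρ = refl
  monoEval-zero (suc m) ρ = trans (*-identityˡ _) (monoEval-zero m (ρ ∘ fsuc))

  monoEval-unitMono : ∀ {m} k (ρ : Fin m → Carrier) (k<m : k < m) → monoEval (unitMono m k) ρ ≈ ρ (fromℕ< k<m)
  monoEval-unitMono {suc m} zero    ρ k<m = trans (*-cong (*-identityʳ _) (monoEval-zero m (ρ ∘ fsuc))) (*-identityʳ _)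
  monoEval-unitMono {suc m} (suc k) ρ k<m = trans (*-identityˡ _) (monoEval-unitMono k (ρ ∘ fsuc) (ℕ.s<s⁻¹ k<m))

  assign-≈ : ∀ N {u v u′ v′} (j : Fin (NV N)) →
             (toℕ j < suc N → u (toℕ j) ≈ u′ (toℕ j)) → (suc N ≤ toℕ j → v (toℕ j ∸ suc N) ≈ v′ (toℕ j ∸ suc N)) →
             assign N u v j ≈ assign N u′ v′ j
  assign-≈ N j u≈u′ v≈v′ with toℕ j <ᵇ suc N in lt
  ... | true  = u≈u′ (<ᵇ⇒< (toℕ j) (suc N) (≡.subst IsTrue (≡.sym lt) tt))
  ... | false = v≈v′ (≮⇒≥ (λ j<1+N → ≡.subst IsTrue lt (<⇒<ᵇ j<1+N)))

  assign-low : ∀ N u v (j : Fin (NV N)) → toℕ j < suc N → assign N u v j ≡ u (toℕ j)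
  assign-low N u v j j<1+N with toℕ j <ᵇ suc N in lt
  ... | true  = ≡.refl
  ... | false = ⊥-elim (≡.subst IsTrue lt (<⇒<ᵇ j<1+N))

  assign-high : ∀ N u v (j : Fin (NV N)) → suc N ≤ toℕ j → assign N u v j ≡ v (toℕ j ∸ suc N)
  assign-high N u v j 1+N≤j with toℕ j <ᵇ suc N in lt
  ... | true  = ⊥-elim (≤⇒≯ 1+N≤j (<ᵇ⇒< (toℕ j) (suc N) (≡.subst IsTrue (≡.sym lt) tt)))
  ... | false = ≡.refl

  assign-x : ∀ N u v → assign N u v (fromℕ< (N<NV N)) ≡ u N
  assign-x N u v = ≡.trans (assign-low N u v _ (≡.subst (_< suc N) (≡.sym toℕ-j≡N) (n<1+n N))) (≡.cong u toℕ-j≡N)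
    where
    toℕ-j≡N : toℕ (fromℕ< (N<NV N)) ≡ N
    toℕ-j≡N = toℕ-fromℕ< (N<NV N)

  assign-y : ∀ N u v → assign N u v (fromℕ< (yIndex<NV N)) ≡ v N
  assign-y N u v = ≡.trans (assign-high N u v _ (≡.subst (suc N ≤_) (≡.sym toℕ-j≡y) (m≤m+n (suc N) N)))
                           (≡.trans (≡.cong (λ k → v (k ∸ suc N)) toℕ-j≡y) (≡.cong v (m+n∸m≡n (suc N) N)))
    where
    toℕ-j≡y : toℕ (fromℕ< (yIndex<NV N)) ≡ yIndex N
    toℕ-j≡y = toℕ-fromℕ< (yIndex<NV N)

module WittAddition {c ℓ : Level} (p : ℕ) .{{_ : NonZero p}} (R : CommutativeRing c ℓ) where

  open Polynomials
  open AdditionPolynomial p R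
  open Evaluation p R
  open Witt p R
  open CommutativeRing R
  import Relation.Binary.Reasoning.Setoid as ≈-Reasoning
  open import Algebra.Properties.Ring ring using (-‿+-comm)
  open import Algebra.Properties.CommutativeSemigroup +-commutativeSemigroup using (interchange)
  open import Data.Nat as ℕ using (suc; _<_; _≤_; _∸_)
  open import Data.Nat.Properties using (<-trans; ≤∧≢⇒<; m<1+n⇒m≤n; m+[n∸m]≡n; +-cancelˡ-<)
  open import Data.Integer using (+_)
  open import Data.Product using (proj₁; proj₂)
  open import Data.Sum using (inj₁; inj₂)
  open import Data.List using ([]; _∷_)
  open import Data.List.Relation.Unary.All as All using ()
  open import Data.Fin using (Fin; toℕ; fromℕ<)
  open import Data.Fin.Properties using (toℕ<n)
  open import Data.Bool using (true)
  open import Relation.Binary.PropositionalEquality as ≡ using (_≡_; _≢_)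
  open import Relation.Nullary using (yes; no)

  AgreeBelow : ℕ → W → W → Set ℓ
  AgreeBelow n u u′ = ∀ i → i < n → u i ≈ u′ i

  assign-agree : ∀ N {u v u′ v′} → AgreeBelow N u u′ → AgreeBelow N v v′ →
                 ∀ (j : Fin (NV N)) → toℕ j ≢ N → toℕ j ≢ yIndex N → assign N u v j ≈ assign N u′ v′ j
  assign-agree N {u} {v} {u′} {v′} u≈u′ v≈v′ j j≢N j≢y = assign-≈ N {u} {v} {u′} {v′} j
    (λ j<1+N → u≈u′ (toℕ j) (≤∧≢⇒< (m<1+n⇒m≤n j<1+N) j≢N))
    (λ 1+N≤j → v≈v′ (toℕ j ∸ suc N) (≤∧≢⇒< (m<1+n⇒m≤n (k<1+N 1+N≤j)) (k≢N 1+N≤j)))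
    where
    k<1+N : suc N ≤ toℕ j → toℕ j ∸ suc N < suc N
    k<1+N 1+N≤j = +-cancelˡ-< (suc N) _ _ (≡.subst (_< NV N) (≡.sym (m+[n∸m]≡n 1+N≤j)) (toℕ<n j))
    k≢N : suc N ≤ toℕ j → toℕ j ∸ suc N ≢ N
    k≢N 1+N≤j k≡N = j≢y (≡.trans (≡.sym (m+[n∸m]≡n 1+N≤j)) (≡.cong (suc N ℕ.+_) k≡N))

  module _ (N : ℕ) where
    open Avoiding N (yIndex N)

    carry : W → W → Carrier
    carry u v = evalP (restrict avoids (Sadd N)) (assign N u v)

    carry-cong : ∀ {u v u′ v′} → AgreeBelow N u u′ → AgreeBelow N v v′ → carry u v ≈ carry u′ v′
    carry-cong {u} {v} {u′} {v′} u≈u′ v≈v′ =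
      evalP-cong (restrict avoids (Sadd N)) (assign N u v) (assign N u′ v′)
                 (All.map (λ {t} → agree-on-variables {proj₂ t}) (restrict-satisfies avoids (Sadd N)))
      where
      agree-on-variables : ∀ {e} → avoids e ≡ true → AgreeOnVariablesOf (assign N u v) (assign N u′ v′) e
      agree-on-variables {e} ae j with toℕ j ℕ.≟ N | toℕ j ℕ.≟ yIndex N
      ... | yes j≡N | _       = inj₁ (≡.trans (≡.cong (exponent e) j≡N) (proj₁ (avoids-elim e ae)))
      ... | no _    | yes j≡y = inj₁ (≡.trans (≡.cong (exponent e) j≡y) (proj₂ (avoids-elim e ae)))
      ... | no j≢N  | no j≢y  = inj₂ (assign-agree N u≈u′ v≈v′ j j≢N j≢y)

    ⊕-decomposition : ∀ u v → (u ⊕ v) N ≈ (u N + v N) + carry u v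
    ⊕-decomposition u v = begin
      evalP (Sadd N) ρ                                               ≈⟨ evalP-restrict avoids (Sadd N) ρ ⟩
      evalP (restrict mentions (Sadd N)) ρ + carry u v               ≡⟨ ≡.cong (λ P → evalP P ρ + carry u v) (restrict-mentions-Sadd N) ⟩
      evalP ((+ 1 , yMono N) ∷ (+ 1 , xMono N) ∷ []) ρ + carry u v   ≈⟨ +-congʳ leading ⟩
      (u N + v N) + carry u v                                        ∎
      where
      open ≈-Reasoning setoid
      ρ : Fin (NV N) → Carrier
      ρ = assign N u v
      leading : evalP ((+ 1 , yMono N) ∷ (+ 1 , xMono N) ∷ []) ρ ≈ u N + v N
      leading = begin
        evalP ((+ 1 , yMono N) ∷ (+ 1 , xMono N) ∷ []) ρ        ≈⟨ evalP-monic (yMono N) ((+ 1 , xMono N) ∷ []) ρ ⟩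
        monoEval (yMono N) ρ + evalP ((+ 1 , xMono N) ∷ []) ρ  ≈⟨ +-congˡ (evalP-monic (xMono N) [] ρ) ⟩
        monoEval (yMono N) ρ + (monoEval (xMono N) ρ + 0#)     ≈⟨ +-cong (monoEval-unitMono (yIndex N) ρ (yIndex<NV N))
                                                                          (trans (+-identityʳ _) (monoEval-unitMono N ρ (N<NV N))) ⟩
        ρ (fromℕ< (yIndex<NV N)) + ρ (fromℕ< (N<NV N))         ≡⟨ ≡.cong₂ _+_ (assign-y N u v) (assign-x N u v) ⟩
        v N + u N                                              ≈⟨ +-comm _ _ ⟩
        u N + v N                                              ∎

  [x+y+e]-[z+w+e]≈[x-z]+[y-w] : ∀ x y z w e → ((x + y) + e) - ((z + w) + e) ≈ (x - z) + (y - w)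
  [x+y+e]-[z+w+e]≈[x-z]+[y-w] x y z w e = begin
    ((x + y) + e) - ((z + w) + e)        ≈⟨ +-congˡ (sym (trans (+-congʳ (-‿+-comm z w)) (-‿+-comm (z + w) e))) ⟩
    ((x + y) + e) + ((- z + - w) + - e)  ≈⟨ interchange (x + y) e (- z + - w) (- e) ⟩
    ((x + y) + (- z + - w)) + (e - e)    ≈⟨ +-cong (interchange x y (- z) (- w)) (-‿inverseʳ e) ⟩
    ((x - z) + (y - w)) + 0#             ≈⟨ +-identityʳ _ ⟩
    (x - z) + (y - w)                    ∎
    where open ≈-Reasoning setoid

  ⊕-agree-below : ∀ n {u v u′ v′} → AgreeBelow n u u′ → AgreeBelow n v v′ → AgreeBelow n (u ⊕ v) (u′ ⊕ v′)
  ⊕-agree-below n {u} {v} {u′} {v′} u≈u′ v≈v′ j j<n = begin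
    (u ⊕ v) j                       ≈⟨ ⊕-decomposition j u v ⟩
    (u j + v j) + carry j u v       ≈⟨ +-cong (+-cong (u≈u′ j j<n) (v≈v′ j j<n)) (carry-cong j (below u≈u′) (below v≈v′)) ⟩
    (u′ j + v′ j) + carry j u′ v′   ≈⟨ ⊕-decomposition j u′ v′ ⟨
    (u′ ⊕ v′) j                     ∎
    where
    open ≈-Reasoning setoid
    below : ∀ {w w′} → AgreeBelow n w w′ → AgreeBelow j w w′
    below w≈w′ i i<j = w≈w′ i (<-trans i<j j<n)

  ⊕-sub : ∀ n {u v u′ v′} → AgreeBelow n u u′ → AgreeBelow n v v′ →
          (u ⊕ v) n - (u′ ⊕ v′) n ≈ (u n - u′ n) + (v n - v′ n)
  ⊕-sub n {u} {v} {u′} {v′} u≈u′ v≈v′ = begin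
    (u ⊕ v) n - (u′ ⊕ v′) n
      ≈⟨ +-cong (⊕-decomposition n u v) (-‿cong (⊕-decomposition n u′ v′)) ⟩
    ((u n + v n) + carry n u v) - ((u′ n + v′ n) + carry n u′ v′)
      ≈⟨ +-congˡ (-‿cong (+-congˡ (sym (carry-cong n u≈u′ v≈v′)))) ⟩
    ((u n + v n) + carry n u v) - ((u′ n + v′ n) + carry n u v)
      ≈⟨ [x+y+e]-[z+w+e]≈[x-z]+[y-w] (u n) (v n) (u′ n) (v′ n) (carry n u v) ⟩
    (u n - u′ n) + (v n - v′ n)
      ∎
    where open ≈-Reasoning setoid

module TeichmüllerSums {c ℓ : Level} (p : ℕ) .{{_ : NonZero p}} (R : CommutativeRing c ℓ) where

  open Polynomials
  open Evaluation p R
  open WittAddition p R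
  open Witt p R
  open CommutativeRing R
  import Relation.Binary.Reasoning.Setoid as ≈-Reasoning
  open import Algebra.Properties.Ring ring using (x≈y⇒x∙y⁻¹≈ε; x∙y⁻¹≈ε⇒x≈y; [y-z]x≈yx-zx; +-cancelʳ; -0#≈0#)
  open import Data.Nat as ℕ using (zero; suc; _<_; _≤_; _≡ᵇ_)
  open import Data.Nat.Properties using (n<1+n; m<1+n⇒m<n∨m≡n; <⇒≢; <⇒≤; ≤-refl; ≤∧≢⇒<; m<1+n⇒m≤n)
  open import Data.Product using (proj₂)
  open import Data.Sum using (inj₁; inj₂)
  open import Data.List using ([]; _∷_; _++_; map; foldr; upTo)
  open import Data.List.Properties using (upTo-∷ʳ; map-++; foldr-++)
  open import Data.List.Relation.Unary.All as All using (All; []; _∷_)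
  open import Data.List.Relation.Unary.All.Properties using (all-upTo)
  open import Data.Bool using (if_then_else_)
  open import Function using (_∘_)
  open import Function.Definitions using (Surjective)
  open import Relation.Binary.PropositionalEquality as ≡ using (_≡_; ≢-sym)
  open import Relation.Nullary using (yes; no)

  Invertible⇒NonZeroDivisor : ∀ {u} → Invertible u → NonZeroDivisor u
  Invertible⇒NonZeroDivisor {u} (v , uv≈1) w uw≈0 = begin
    w             ≈⟨ *-identityˡ w ⟨
    1# * w        ≈⟨ *-congʳ (trans (sym uv≈1) (*-comm u v)) ⟩
    (v * u) * w   ≈⟨ *-assoc v u w ⟩
    v * (u * w)   ≈⟨ *-congˡ uw≈0 ⟩
    v * 0#        ≈⟨ zeroʳ v ⟩
    0#            ∎
    where open ≈-Reasoning setoid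

  DifferAt : ℕ → Carrier → W → W → Set ℓ
  DifferAt n δ u u′ = AgreeBelow n u u′ × (u n - u′ n ≈ δ)

  DifferAt-resp : ∀ {n δ δ′ u u′} → δ ≈ δ′ → DifferAt n δ u u′ → DifferAt n δ′ u u′
  DifferAt-resp δ≈δ′ (u≈u′ , gap) = u≈u′ , trans gap δ≈δ′

  ≈W⇒DifferAt : ∀ n {u u′} → u ≈W u′ → DifferAt n 0# u u′
  ≈W⇒DifferAt n u≈u′ = (λ i _ → u≈u′ i) , x≈y⇒x∙y⁻¹≈ε (u≈u′ n)

  ⊕-DifferAt : ∀ n {δ ε u v u′ v′} → DifferAt n δ u u′ → DifferAt n ε v v′ → DifferAt n (δ + ε) (u ⊕ v) (u′ ⊕ v′)
  ⊕-DifferAt n (u≈u′ , δ-gap) (v≈v′ , ε-gap) =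
    ⊕-agree-below n u≈u′ v≈v′ , trans (⊕-sub n u≈u′ v≈v′) (+-cong δ-gap ε-gap)

  foldr-⊕-DifferAt : ∀ n {δ B B′} (f g : ℕ → W) ks → All (λ k → f k ≈W g k) ks → DifferAt n δ B B′ →
                     DifferAt n δ (foldr _⊕_ B (map f ks)) (foldr _⊕_ B′ (map g ks))
  foldr-⊕-DifferAt n f g []       []             B-gap = B-gap
  foldr-⊕-DifferAt n f g (k ∷ ks) (fk≈gk ∷ f≈g) B-gap =
    DifferAt-resp (+-identityˡ _) (⊕-DifferAt n (≈W⇒DifferAt n fk≈gk) (foldr-⊕-DifferAt n f g ks f≈g B-gap))

  ⊗-cong : ∀ {u v u′ v′} → u ≈W u′ → v ≈W v′ → (u ⊗ v) ≈W (u′ ⊗ v′)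
  ⊗-cong {u} {v} {u′} {v′} u≈u′ v≈v′ n =
    evalP-cong (Pmul n) _ _
      (All.universal (λ _ j → inj₂ (assign-≈ n {u} {v} {u′} {v′} j (λ _ → u≈u′ _) (λ _ → v≈v′ _))) (Pmul n))

  teich-cong : ∀ {a b} → a ≈ b → teich a ≈W teich b
  teich-cong a≈b zero    = a≈b
  teich-cong a≈b (suc n) = refl

  teich-⊗-0 : ∀ a x → (teich a ⊗ x) 0 ≈ a * x 0
  teich-⊗-0 a x = begin
    (teich a ⊗ x) 0                                  ≡⟨⟩
    (1# + 0#) * ((a * 1#) * ((x 0 * 1#) * 1#)) + 0#  ≈⟨ +-identityʳ _ ⟩
    (1# + 0#) * ((a * 1#) * ((x 0 * 1#) * 1#))       ≈⟨ trans (*-congʳ (+-identityʳ 1#)) (*-identityˡ _) ⟩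
    (a * 1#) * ((x 0 * 1#) * 1#)                     ≈⟨ *-cong (*-identityʳ a) (trans (*-identityʳ _) (*-identityʳ _)) ⟩
    a * x 0                                          ∎
    where open ≈-Reasoning setoid

  Ver^-below : ∀ k w {j} → j < k → Ver^ k w j ≡ 0#
  Ver^-below (suc k) w {zero}  j<k = ≡.refl
  Ver^-below (suc k) w {suc j} j<k = Ver^-below k w (ℕ.s<s⁻¹ j<k)

  Ver^-at : ∀ k w → Ver^ k w k ≡ w 0
  Ver^-at zero    w = ≡.refl
  Ver^-at (suc k) w = Ver^-at k w

  Ver^-cong : ∀ k {w w′} → w ≈W w′ → Ver^ k w ≈W Ver^ k w′
  Ver^-cong zero    w≈w′ j       = w≈w′ j
  Ver^-cong (suc k) w≈w′ zero    = refl
  Ver^-cong (suc k) w≈w′ (suc j) = Ver^-cong k w≈w′ j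

  module _ (x : W) where

    term : W → ℕ → W
    term a k = Ver^ k (teich (a k) ⊗ x)

    term-cong : ∀ {a b} k → a k ≈ b k → term a k ≈W term b k
    term-cong k ak≈bk = Ver^-cong k (⊗-cong {v = x} (teich-cong ak≈bk) (λ _ → refl))

    term-DifferAt : ∀ n a b → DifferAt n ((a n - b n) * x 0) (term a n) (term b n)
    term-DifferAt n a b = (λ j j<n → reflexive (≡.trans (Ver^-below n _ j<n) (≡.sym (Ver^-below n _ j<n)))) ,
      (begin
      term a n n - term b n n                   ≡⟨ ≡.cong₂ _-_ (Ver^-at n _) (Ver^-at n _) ⟩
      (teich (a n) ⊗ x) 0 - (teich (b n) ⊗ x) 0  ≈⟨ +-cong (teich-⊗-0 (a n) x) (-‿cong (teich-⊗-0 (b n) x)) ⟩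
      a n * x 0 - b n * x 0                     ≈⟨ [y-z]x≈yx-zx (x 0) (a n) (b n) ⟨
      (a n - b n) * x 0                         ∎)
      where open ≈-Reasoning setoid

    T-unfold : ∀ a n → T a x n ≡ foldr _⊕_ (term a n ⊕ zeroW) (map (term a) (upTo n)) n
    T-unfold a n = ≡.cong (λ w → w n) (begin
      foldr _⊕_ zeroW (map (term a) (upTo (suc n)))
        ≡⟨ ≡.cong (foldr _⊕_ zeroW ∘ map (term a)) (≡.sym (upTo-∷ʳ n)) ⟩
      foldr _⊕_ zeroW (map (term a) (upTo n ++ n ∷ []))
        ≡⟨ ≡.cong (foldr _⊕_ zeroW) (map-++ (term a) (upTo n) (n ∷ [])) ⟩
      foldr _⊕_ zeroW (map (term a) (upTo n) ++ term a n ∷ [])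
        ≡⟨ foldr-++ _⊕_ zeroW (map (term a) (upTo n)) (term a n ∷ []) ⟩
      foldr _⊕_ (term a n ⊕ zeroW) (map (term a) (upTo n))
        ∎)
      where open ≡.≡-Reasoning

    T-sub : ∀ n {a b} → AgreeBelow n a b → T a x n - T b x n ≈ (a n - b n) * x 0
    T-sub n {a} {b} a≈b = begin
      T a x n - T b x n                       ≡⟨ ≡.cong₂ _-_ (T-unfold a n) (T-unfold b n) ⟩
      unfolded a n - unfolded b n             ≈⟨ proj₂ (foldr-⊕-DifferAt n (term a) (term b) (upTo n) earlier-terms last-term) ⟩
      (a n - b n) * x 0                       ∎
      where
      open ≈-Reasoning setoid
      unfolded : W → ℕ → Carrier
      unfolded a n = foldr _⊕_ (term a n ⊕ zeroW) (map (term a) (upTo n)) n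
      earlier-terms : All (λ k → term a k ≈W term b k) (upTo n)
      earlier-terms = All.map (λ {k} k<n → term-cong {a} {b} k (a≈b k k<n)) (all-upTo n)
      last-term : DifferAt n ((a n - b n) * x 0) (term a n ⊕ zeroW) (term b n ⊕ zeroW)
      last-term = DifferAt-resp (+-identityʳ _) (⊕-DifferAt n (term-DifferAt n a b) (≈W⇒DifferAt n {zeroW} (λ _ → refl)))

    T-cong : ∀ {a b} → a ≈W b → T a x ≈W T b x
    T-cong {a} {b} a≈b n = x∙y⁻¹≈ε⇒x≈y _ _ (begin
      T a x n - T b x n   ≈⟨ T-sub n (λ i _ → a≈b i) ⟩
      (a n - b n) * x 0   ≈⟨ *-congʳ (x≈y⇒x∙y⁻¹≈ε (a≈b n)) ⟩
      0# * x 0            ≈⟨ zeroˡ (x 0) ⟩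
      0#                  ∎)
      where open ≈-Reasoning setoid

    T-injective : NonZeroDivisor (x 0) → Injective _≈W_ _≈W_ (λ a → T a x)
    T-injective x₀-regular {a} {b} Ta≈Tb n = agree (suc n) n (n<1+n n)
      where
      agree : ∀ n → AgreeBelow n a b
      agree (suc n) i i<1+n with m<1+n⇒m<n∨m≡n i<1+n
      ... | inj₁ i<n    = agree n i i<n
      ... | inj₂ ≡.refl = x∙y⁻¹≈ε⇒x≈y _ _ (x₀-regular _ (begin
        x 0 * (a i - b i)   ≈⟨ *-comm _ _ ⟩
        (a i - b i) * x 0   ≈⟨ T-sub i (agree i) ⟨
        T a x i - T b x i   ≈⟨ x≈y⇒x∙y⁻¹≈ε (Ta≈Tb i) ⟩
        0#                  ∎))
        where open ≈-Reasoning setoid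

    T-surjective : Invertible (x 0) → Surjective _≈W_ _≈W_ (λ a → T a x)
    T-surjective (v , x₀v≈1) y = solution , λ z≈solution n → trans (T-cong z≈solution n) (T-solution n)
      where
      prefix : ℕ → W
      prefix zero    = zeroW
      prefix (suc n) j = if j ≡ᵇ n then v * (y n - T (prefix n) x n) else prefix n j

      solution : W
      solution n = prefix (suc n) n

      solution-eq : ∀ n → solution n ≡ v * (y n - T (prefix n) x n)
      solution-eq n rewrite ≡ᵇ-refl n = ≡.refl

      prefix-above : ∀ n {j} → n ≤ j → prefix n j ≡ 0#
      prefix-above zero    n≤j = ≡.refl
      prefix-above (suc n) {j} n<j rewrite ≢⇒≡ᵇ-false j n (≢-sym (<⇒≢ n<j)) = prefix-above n (<⇒≤ n<j)

      prefix-below : ∀ n {j} → j < n → prefix n j ≡ solution j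
      prefix-below (suc n) {j} j<1+n with j ℕ.≟ n
      ... | yes ≡.refl = ≡.refl
      ... | no j≢n rewrite ≢⇒≡ᵇ-false j n j≢n = prefix-below n (≤∧≢⇒< (m<1+n⇒m≤n j<1+n) j≢n)

      T-solution : ∀ n → T solution x n ≈ y n
      T-solution n = +-cancelʳ (- Tₚ) _ _ (begin
        T solution x n - Tₚ                       ≈⟨ T-sub n (λ j j<n → reflexive (≡.sym (prefix-below n j<n))) ⟩
        (solution n - prefix n n) * x 0            ≡⟨ ≡.cong₂ (λ s t → (s - t) * x 0) (solution-eq n) (prefix-above n ≤-refl) ⟩
        (v * (y n - Tₚ) - 0#) * x 0                ≈⟨ *-congʳ (trans (+-congˡ -0#≈0#) (+-identityʳ _)) ⟩
        (v * (y n - Tₚ)) * x 0                     ≈⟨ *-congʳ (*-comm v _) ⟩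
        ((y n - Tₚ) * v) * x 0                     ≈⟨ *-assoc _ v (x 0) ⟩
        (y n - Tₚ) * (v * x 0)                     ≈⟨ *-congˡ (trans (*-comm v (x 0)) x₀v≈1) ⟩
        (y n - Tₚ) * 1#                            ≈⟨ *-identityʳ _ ⟩
        y n - Tₚ                                   ∎)
        where
        open ≈-Reasoning setoid
        Tₚ : Carrier
        Tₚ = T (prefix n) x n

lemma6p1p5 : {c ℓ : Level} (p : ℕ) → Prime p → (R : CommutativeRing c ℓ) →
    let open Witt p R in
    (x : W) →
      (NonZeroDivisor (x 0) → Injective _≈W_ _≈W_ (λ a → T a x)) ×
      (Invertible (x 0) → Bijective _≈W_ _≈W_ (λ a → T a x))
lemma6p1p5 p p-prime R x =
  T-injective x , λ x₀-invertible → T-injective x (Invertible⇒NonZeroDivisor x₀-invertible) , T-surjective x x₀-invertible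
  where open TeichmüllerSums p {{prime⇒nonZero p-prime}} R
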